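{- Let $G$ be a finite simple graph. Then there exists a maximal matching $E_0$ of $G$ with $|E_0|=\tau(G)$.
   Context: For $E_0\subseteq E(G)$, $V(E_0)$ denotes the set of endpoints of edges in $E_0$. $\Theta(G)$ is the family of all $E_0\subseteq E(G)$ such that $V(G)\setminus V(E_0)$ is an independent set of $G$, and $\tau(G)$ is the minimum of $|E_0|$ over $E_0\in\Theta(G)$. -}

module Defs where

open import Data.Nat using (ℕ; _<_; _≤_)
open import Data.Fin using (Fin; toℕ)
open import Data.Bool using (Bool; true; false)
open import Data.Product using (_×_; _,_; proj₁; proj₂; ∃-syntax)
open import Data.Sum using (_⊎_)
open import Data.List using (List; length)
open import Data.List.Membership.Propositional using (_∈_)
open import Data.List.Relation.Unary.All using (All)
open import Data.List.Relation.Unary.Unique.Propositional using (Unique)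
open import Relation.Binary.PropositionalEquality using (_≡_; _≢_)
open import Relation.Nullary using (¬_)

record Graph : Set where
  field
    n     : ℕ
    adj   : Fin n → Fin n → Bool
    sym   : ∀ u v → adj u v ≡ adj v u
    irrefl : ∀ v → adj v v ≡ false
open Graph public

-- An edge {u,v} is represented canonically as the ordered pair (u , v) with u < v.
Pair : Graph → Set
Pair G = Fin (n G) × Fin (n G)

IsEdge : (G : Graph) → Pair G → Set
IsEdge G (u , v) = (toℕ u < toℕ v) × (adj G u v ≡ true)

record EdgeSet (G : Graph) : Set where
  field
    edges  : List (Pair G)
    valid  : All (IsEdge G) edges
    unique : Unique edges
open EdgeSet public

size : {G : Graph} → EdgeSet G → ℕ
size E = length (edges E)

_⊆E_ : {G : Graph} → EdgeSet G → EdgeSet G → Set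
E ⊆E F = ∀ {e} → e ∈ edges E → e ∈ edges F

Covered : {G : Graph} → EdgeSet G → Fin (n G) → Set
Covered E v = ∃[ e ] (e ∈ edges E × (v ≡ proj₁ e ⊎ v ≡ proj₂ e))

InTheta : {G : Graph} → EdgeSet G → Set
InTheta {G} E = ∀ u v → ¬ Covered E u → ¬ Covered E v → adj G u v ≡ false

IsTau : Graph → ℕ → Set
IsTau G t = (∃[ E ] (InTheta {G} E × size E ≡ t))
          × (∀ (E : EdgeSet G) → InTheta E → t ≤ size E)

Meet : {G : Graph} → Pair G → Pair G → Set
Meet (a , b) (c , d) = (a ≡ c ⊎ a ≡ d) ⊎ (b ≡ c ⊎ b ≡ d)

IsMatching : {G : Graph} → EdgeSet G → Set
IsMatching {G} E = ∀ {e f} → e ∈ edges E → f ∈ edges E → e ≢ f → ¬ Meet {G} e f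

IsMaximalMatching : {G : Graph} → EdgeSet G → Set
IsMaximalMatching {G} E = IsMatching E
  × (∀ (F : EdgeSet G) → IsMatching F → E ⊆E F → F ⊆E E)

-- Among the edge sets in Θ(G) of minimum size choose one covering as many
-- vertices as possible.  It is a matching: if two of its edges shared a
-- vertex u, let f = uw be one of them and drop f.  If some neighbour x of w
-- is now uncovered, adding wx gives a set in Θ(G) of the same size covering
-- strictly more vertices; otherwise the smaller set is already in Θ(G).
-- It is a maximal matching because an edge joining two uncovered vertices
-- would contradict independence of the uncovered set.
module Submission where

open import Defs hiding (sym)
open import Data.Bool using (true; false)
import Data.Bool.Properties as Bool
open import Data.Fin using (Fin; toℕ; _≟_)
open import Data.Fin.Properties using (all?; any?; toℕ-injective)
open import Data.List using (List; []; _∷_; length; filter; map; _++_; cartesianProduct; allFin)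
open import Data.List.Extrema.Nat using (argmin; argmin-all; f[argmin]≤f[xs])
open import Data.List.Membership.Propositional using (_∈_; find; lose)
open import Data.List.Membership.Propositional.Properties
  using (∈-filter⁺; ∈-filter⁻; ∈-map⁺; ∈-map⁻; ∈-++⁺ˡ; ∈-++⁺ʳ; ∈-++⁻; ∈-allFin; ∈-cartesianProduct⁺)
open import Data.List.Properties using (filter-notAll; length-filter; length-tabulate)
open import Data.List.Relation.Binary.Sublist.Propositional using (_⊆_; []; _∷_; _∷ʳ_; ⊆-refl)
open import Data.List.Relation.Binary.Sublist.Propositional.Properties
  using (All-resp-⊆; filter-⊆; filter⁺; length-mono-≤)
open import Data.List.Relation.Unary.All as All using (All; []; _∷_)
open import Data.List.Relation.Unary.All.Properties using (all-filter)
open import Data.List.Relation.Unary.AllPairs using ([]; _∷_)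
open import Data.List.Relation.Unary.Any as Any using (here; there)
open import Data.List.Relation.Unary.Unique.Propositional using (Unique)
import Data.List.Relation.Unary.Unique.Propositional.Properties as Unique
open import Data.Nat using (ℕ; suc; _+_; _*_; _≤_; _<_; z≤n; s≤s; _<?_)
open import Data.Nat.Properties
  using (≤-trans; <⇒≱; ≮⇒≥; <-cmp; m≤m+n; m≤n⇒m≤1+n; +-comm; +-mono-≤; +-mono-≤-<; +-monoʳ-<; *-monoˡ-≤; module ≤-Reasoning)
open import Data.Product using (_×_; _,_; proj₁; proj₂; ∃-syntax)
open import Data.Product.Properties using (≡-dec)
open import Data.Sum using (_⊎_; inj₁; inj₂)
open import Level using (0ℓ)
open import Relation.Binary.Definitions using (DecidableEquality; tri<; tri≈; tri>)
open import Relation.Binary.PropositionalEquality using (_≡_; _≢_; refl; sym; trans; subst)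
open import Relation.Nullary using (¬_; Dec; yes; no; contradiction)
open import Relation.Nullary.Decidable using (_×-dec_; _⊎-dec_; _→-dec_; ¬?; map′; decidable-stable)
open import Relation.Unary using (Pred; Decidable)

lex-< : ∀ {a b x y} k → x < k → a < b → a * k + x < b * k + y
lex-< {a} {b} {x} {y} k x<k a<b = begin-strict
  a * k + x  <⟨ +-monoʳ-< (a * k) x<k ⟩
  a * k + k  ≡⟨ +-comm (a * k) k ⟩
  suc a * k  ≤⟨ *-monoˡ-≤ k a<b ⟩
  b * k      ≤⟨ m≤m+n (b * k) y ⟩
  b * k + y  ∎
  where open ≤-Reasoning

lex-≤⇒≤ : ∀ {a b x y} k → y < k → a * k + x ≤ b * k + y → a ≤ b
lex-≤⇒≤ k y<k le = ≮⇒≥ (λ b<a → <⇒≱ (lex-< k y<k b<a) le)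

module _ {A : Set} {P Q : Pred A 0ℓ} (P? : Decidable P) (Q? : Decidable Q)
         (P⇒Q : ∀ {x} → P x → Q x) where

  length-filter-mono : ∀ xs → length (filter P? xs) ≤ length (filter Q? xs)
  length-filter-mono xs = length-mono-≤ (filter⁺ P? Q? (λ { refl → P⇒Q }) (⊆-refl {x = xs}))

  length-filter-mono-< : ∀ {x} xs → x ∈ xs → Q x → ¬ P x →
                         length (filter P? xs) < length (filter Q? xs)
  length-filter-mono-< (y ∷ xs) (here refl) qy ¬py with P? y | Q? y
  ... | yes py | _      = contradiction py ¬py
  ... | no _   | yes _  = s≤s (length-filter-mono xs)
  ... | no _   | no ¬qy = contradiction qy ¬qy
  length-filter-mono-< (y ∷ xs) (there x∈xs) qx ¬px with P? y | Q? y
  ... | yes py | yes _  = s≤s (length-filter-mono-< xs x∈xs qx ¬px)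
  ... | yes py | no ¬qy = contradiction (P⇒Q py) ¬qy
  ... | no _   | yes _  = m≤n⇒m≤1+n (length-filter-mono-< xs x∈xs qx ¬px)
  ... | no _   | no _   = length-filter-mono-< xs x∈xs qx ¬px

module _ {A : Set} where

  sublists : List A → List (List A)
  sublists []       = [] ∷ []
  sublists (x ∷ xs) = map (x ∷_) (sublists xs) ++ sublists xs

  ∈-sublists⁺ : ∀ {xs ys : List A} → ys ⊆ xs → ys ∈ sublists xs
  ∈-sublists⁺ {[]}     []           = here refl
  ∈-sublists⁺ {x ∷ xs} (x ∷ʳ ys⊆)   = ∈-++⁺ʳ (map (x ∷_) (sublists xs)) (∈-sublists⁺ ys⊆)
  ∈-sublists⁺ {x ∷ xs} (refl ∷ ys⊆) = ∈-++⁺ˡ (∈-map⁺ (x ∷_) (∈-sublists⁺ ys⊆))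

  ∈-sublists⁻ : ∀ {xs ys : List A} → ys ∈ sublists xs → ys ⊆ xs
  ∈-sublists⁻ {[]}     (here refl) = []
  ∈-sublists⁻ {x ∷ xs} ys∈ with ∈-++⁻ (map (x ∷_) (sublists xs)) ys∈
  ... | inj₂ ys∈′ = x ∷ʳ ∈-sublists⁻ ys∈′
  ... | inj₁ ys∈′ with ∈-map⁻ (x ∷_) ys∈′
  ...   | _ , zs∈ , refl = refl ∷ ∈-sublists⁻ zs∈

  Unique-resp-⊇ : ∀ {xs ys : List A} → xs ⊆ ys → Unique ys → Unique xs
  Unique-resp-⊇ []          []          = []
  Unique-resp-⊇ (_ ∷ʳ xs⊆)  (_ ∷ u)     = Unique-resp-⊇ xs⊆ u
  Unique-resp-⊇ (refl ∷ xs⊆) (x∉ys ∷ u) = All-resp-⊆ xs⊆ x∉ys ∷ Unique-resp-⊇ xs⊆ u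

  length-≤-Unique : DecidableEquality A → ∀ {xs ys : List A} → Unique xs →
                    (∀ {z} → z ∈ xs → z ∈ ys) → length xs ≤ length ys
  length-≤-Unique _≟_ {[]}     _            _     = z≤n
  length-≤-Unique _≟_ {x ∷ xs} {ys} (x∉xs ∷ u) xs⊆ys =
    ≤-trans (s≤s (length-≤-Unique _≟_ u xs⊆ys-x))
            (filter-notAll ≢x? ys (Any.map (λ x≡y y≢x → y≢x (sym x≡y)) (xs⊆ys (here refl))))
    where
    ≢x? : Decidable (_≢ x)
    ≢x? y = ¬? (y ≟ x)
    xs⊆ys-x : ∀ {z} → z ∈ xs → z ∈ filter ≢x? ys
    xs⊆ys-x z∈xs = ∈-filter⁺ ≢x? (xs⊆ys (there z∈xs)) (λ z≡x → All.lookup x∉xs z∈xs (sym z≡x))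

module _ (G : Graph) where

  Vertex : Set
  Vertex = Fin (n G)

  Edge : Set
  Edge = Pair G

  _≟ₑ_ : DecidableEquality Edge
  _≟ₑ_ = ≡-dec _≟_ _≟_

  open import Data.List.Membership.DecPropositional _≟ₑ_ using (_∈?_)

  Ends : Vertex → Edge → Set
  Ends v (a , b) = v ≡ a ⊎ v ≡ b

  Joins : Edge → Vertex → Vertex → Set
  Joins f u w = f ≡ (u , w) ⊎ f ≡ (w , u)

  CoveredBy : List Edge → Vertex → Set
  CoveredBy ys v = ∃[ e ] (e ∈ ys × Ends v e)

  InΘ : List Edge → Set
  InΘ ys = ∀ u v → ¬ CoveredBy ys u → ¬ CoveredBy ys v → adj G u v ≡ false

  AreEdges : List Edge → Set
  AreEdges = All (IsEdge G)

  Meet⇒shared : ∀ {e f} → Meet {G} e f → ∃[ v ] (Ends v e × Ends v f)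
  Meet⇒shared {a , _} (inj₁ (inj₁ a≡c)) = a , inj₁ refl , inj₁ a≡c
  Meet⇒shared {a , _} (inj₁ (inj₂ a≡d)) = a , inj₁ refl , inj₂ a≡d
  Meet⇒shared {_ , b} (inj₂ (inj₁ b≡c)) = b , inj₂ refl , inj₁ b≡c
  Meet⇒shared {_ , b} (inj₂ (inj₂ b≡d)) = b , inj₂ refl , inj₂ b≡d

  shared⇒Meet : ∀ {v e f} → Ends v e → Ends v f → Meet {G} e f
  shared⇒Meet (inj₁ refl) (inj₁ refl) = inj₁ (inj₁ refl)
  shared⇒Meet (inj₁ refl) (inj₂ refl) = inj₁ (inj₂ refl)
  shared⇒Meet (inj₂ refl) (inj₁ refl) = inj₂ (inj₁ refl)
  shared⇒Meet (inj₂ refl) (inj₂ refl) = inj₂ (inj₂ refl)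

  Ends⇒Joins : ∀ {u f} → Ends u f → ∃[ w ] Joins f u w
  Ends⇒Joins {f = _ , b} (inj₁ refl) = b , inj₁ refl
  Ends⇒Joins {f = a , _} (inj₂ refl) = a , inj₂ refl

  Joins⇒Ends : ∀ {f u w v} → Joins f u w → Ends v f → v ≡ u ⊎ v ≡ w
  Joins⇒Ends (inj₁ refl) v∈f = v∈f
  Joins⇒Ends (inj₂ refl) (inj₁ v≡w) = inj₂ v≡w
  Joins⇒Ends (inj₂ refl) (inj₂ v≡u) = inj₁ v≡u

  adj⇒≢ : ∀ {u v} → adj G u v ≡ true → u ≢ v
  adj⇒≢ {u} uv refl = contradiction (trans (sym uv) (irrefl G u)) λ ()

  edgeBetween : ∀ {u v} → adj G u v ≡ true → ∃[ e ] (IsEdge G e × Ends u e × Ends v e)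
  edgeBetween {u} {v} uv with <-cmp (toℕ u) (toℕ v)
  ... | tri< u<v _ _ = (u , v) , (u<v , uv) , inj₁ refl , inj₂ refl
  ... | tri≈ _ u≡v _ = contradiction (toℕ-injective u≡v) (adj⇒≢ uv)
  ... | tri> _ _ v<u = (v , u) , (v<u , trans (Graph.sym G v u) uv) , inj₂ refl , inj₁ refl

  covered? : ∀ ys v → Dec (CoveredBy ys v)
  covered? ys v = map′ find (λ (_ , e∈ys , v∈e) → lose e∈ys v∈e)
                       (Any.any? (λ (a , b) → (v ≟ a) ⊎-dec (v ≟ b)) ys)

  InΘ? : Decidable InΘ
  InΘ? ys = all? λ u → all? λ v →
    ¬? (covered? ys u) →-dec (¬? (covered? ys v) →-dec (adj G u v Bool.≟ false))

  InΘ-mono : ∀ {xs ys} → (∀ {v} → CoveredBy xs v → CoveredBy ys v) → InΘ xs → InΘ ys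
  InΘ-mono xs⇒ys θ u v u∉ys v∉ys = θ u v (λ c → u∉ys (xs⇒ys c)) (λ c → v∉ys (xs⇒ys c))

  isEdge? : Decidable (IsEdge G)
  isEdge? (u , v) = (toℕ u <? toℕ v) ×-dec (adj G u v Bool.≟ true)

  allPairs : List Edge
  allPairs = cartesianProduct (allFin (n G)) (allFin (n G))

  allEdges : List Edge
  allEdges = filter isEdge? allPairs

  allEdges-AreEdges : AreEdges allEdges
  allEdges-AreEdges = all-filter isEdge? allPairs

  allEdges-Unique : Unique allEdges
  allEdges-Unique = Unique.filter⁺ isEdge? (Unique.cartesianProduct⁺ (Unique.allFin⁺ _) (Unique.allFin⁺ _))

  ∈-allEdges : ∀ {e} → IsEdge G e → e ∈ allEdges
  ∈-allEdges {u , v} e-edge = ∈-filter⁺ isEdge? (∈-cartesianProduct⁺ (∈-allFin u) (∈-allFin v)) e-edge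

  allEdges-InΘ : InΘ allEdges
  allEdges-InΘ u v u∉ _ = Bool.¬-not λ uv →
    let (e , e-edge , u∈e , _) = edgeBetween uv in u∉ (e , ∈-allEdges e-edge , u∈e)

  uncovered : List Edge → ℕ
  uncovered ys = length (filter (λ v → ¬? (covered? ys v)) (allFin (n G)))

  uncovered<1+n : ∀ ys → uncovered ys < suc (n G)
  uncovered<1+n ys = s≤s (subst (uncovered ys ≤_) (length-tabulate (λ v → v))
                               (length-filter (λ v → ¬? (covered? ys v)) (allFin (n G))))

  uncovered-mono : ∀ {xs ys} → (∀ {v} → CoveredBy xs v → CoveredBy ys v) →
                   uncovered ys ≤ uncovered xs
  uncovered-mono {xs} {ys} xs⇒ys =
    length-filter-mono (λ v → ¬? (covered? ys v)) (λ v → ¬? (covered? xs v))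
                       (λ v∉ys v∈xs → v∉ys (xs⇒ys v∈xs)) (allFin (n G))

  uncovered-mono-< : ∀ {xs ys x} → (∀ {v} → CoveredBy xs v → CoveredBy ys v) →
                     CoveredBy ys x → ¬ CoveredBy xs x → uncovered ys < uncovered xs
  uncovered-mono-< {xs} {ys} {x} xs⇒ys x∈ys x∉xs =
    length-filter-mono-< (λ v → ¬? (covered? ys v)) (λ v → ¬? (covered? xs v))
                         (λ v∉ys v∈xs → v∉ys (xs⇒ys v∈xs)) (allFin (n G))
                         (∈-allFin x) x∉xs (λ x∉ys → x∉ys x∈ys)

  -- Orders edge lists by size, then by the number of uncovered vertices.
  weight : List Edge → ℕ
  weight ys = length ys * suc (n G) + uncovered ys

  Improvable : List Edge → Set
  Improvable ys = ∃[ zs ] (AreEdges zs × InΘ zs × weight zs < weight ys)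

  covered-∷ : ∀ {e ys v} → CoveredBy ys v → CoveredBy (e ∷ ys) v
  covered-∷ (g , g∈ys , v∈g) = g , there g∈ys , v∈g

  -- Moves an edge list into the search space of best, the sublists of allEdges,
  -- without increasing its weight.
  restrict : List Edge → List Edge
  restrict ys = filter (_∈? ys) allEdges

  module _ {ys} (ys-edges : AreEdges ys) where

    restrict-covers : ∀ {v} → CoveredBy ys v → CoveredBy (restrict ys) v
    restrict-covers (e , e∈ys , v∈e) =
      e , ∈-filter⁺ (_∈? ys) (∈-allEdges (All.lookup ys-edges e∈ys)) e∈ys , v∈e

    weight-restrict : weight (restrict ys) ≤ weight ys
    weight-restrict = +-mono-≤ (*-monoˡ-≤ (suc (n G)) length-restrict) (uncovered-mono restrict-covers)
      where
      length-restrict : length (restrict ys) ≤ length ys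
      length-restrict = length-≤-Unique _≟ₑ_ (Unique.filter⁺ (_∈? ys) allEdges-Unique)
                                        (λ e∈ → proj₂ (∈-filter⁻ (_∈? ys) {xs = allEdges} e∈))

  best : List Edge
  best = argmin weight allEdges (filter InΘ? (sublists allEdges))

  best-⊆-InΘ : best ⊆ allEdges × InΘ best
  best-⊆-InΘ = argmin-all weight (⊆-refl , allEdges-InΘ) (All.tabulate candidate)
    where
    candidate : ∀ {ys} → ys ∈ filter InΘ? (sublists allEdges) → ys ⊆ allEdges × InΘ ys
    candidate ys∈ = let (ys∈sublists , θ) = ∈-filter⁻ InΘ? ys∈ in ∈-sublists⁻ ys∈sublists , θ

  best-AreEdges : AreEdges best
  best-AreEdges = All-resp-⊆ (proj₁ best-⊆-InΘ) allEdges-AreEdges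

  best-InΘ : InΘ best
  best-InΘ = proj₂ best-⊆-InΘ

  best-minimal : ∀ {ys} → AreEdges ys → InΘ ys → weight best ≤ weight ys
  best-minimal {ys} ys-edges θ = ≤-trans
    (All.lookup (f[argmin]≤f[xs] {f = weight} allEdges (filter InΘ? (sublists allEdges)))
                (∈-filter⁺ InΘ? (∈-sublists⁺ (filter-⊆ (_∈? ys) allEdges))
                                (InΘ-mono (restrict-covers ys-edges) θ)))
    (weight-restrict ys-edges)

  best-unimprovable : ¬ Improvable best
  best-unimprovable (_ , zs-edges , θ , lighter) = <⇒≱ lighter (best-minimal zs-edges θ)

  without : Edge → List Edge → List Edge
  without f = filter (λ g → ¬? (g ≟ₑ f))

  module Exchange {ys f u w} (ys-edges : AreEdges ys) (θ : InΘ ys) (f∈ys : f ∈ ys)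
                  (f-joins : Joins f u w) (u∈rest : CoveredBy (without f ys) u) where

    rest : List Edge
    rest = without f ys

    rest-edges : AreEdges rest
    rest-edges = All-resp-⊆ (filter-⊆ _ ys) ys-edges

    rest-shorter : length rest < length ys
    rest-shorter = filter-notAll _ ys (Any.map (λ { refl f≢f → f≢f refl }) f∈ys)

    rest-covers : ∀ {v} → CoveredBy ys v → v ≢ w → CoveredBy rest v
    rest-covers (g , g∈ys , v∈g) v≢w with g ≟ₑ f
    ... | no g≢f = g , ∈-filter⁺ _ g∈ys g≢f , v∈g
    ... | yes refl with Joins⇒Ends f-joins v∈g
    ...   | inj₁ refl = u∈rest
    ...   | inj₂ v≡w  = contradiction v≡w v≢w

    swap : ∀ {x e} → IsEdge G e → Ends w e → Ends x e → x ≢ w → ¬ CoveredBy rest x →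
           Improvable ys
    swap {x} {e} e-edge w∈e x∈e x≢w x∉rest =
      e ∷ rest , e-edge ∷ rest-edges , InΘ-mono covers θ ,
      +-mono-≤-< (*-monoˡ-≤ (suc (n G)) rest-shorter)
                 (uncovered-mono-< covers (e , here refl , x∈e)
                                   (λ x∈ys → x∉rest (rest-covers x∈ys x≢w)))
      where
      covers : ∀ {v} → CoveredBy ys v → CoveredBy (e ∷ rest) v
      covers {v} v∈ys with v ≟ w
      ... | yes refl = e , here refl , w∈e
      ... | no v≢w   = covered-∷ (rest-covers v∈ys v≢w)

    drop : (∀ {x} → adj G w x ≡ true → CoveredBy rest x) → Improvable ys
    drop neighbours-covered =
      rest , rest-edges , rest-InΘ , lex-< (suc (n G)) (uncovered<1+n rest) rest-shorter
      where
      rest-InΘ : InΘ rest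
      rest-InΘ a b a∉ b∉ with a ≟ w | b ≟ w
      ... | yes refl | _        = Bool.¬-not λ wb → b∉ (neighbours-covered wb)
      ... | no _     | yes refl = Bool.¬-not λ aw → a∉ (neighbours-covered (trans (Graph.sym G w a) aw))
      ... | no a≢w   | no b≢w   =
        θ a b (λ a∈ys → a∉ (rest-covers a∈ys a≢w)) (λ b∈ys → b∉ (rest-covers b∈ys b≢w))

    improve : Improvable ys
    improve with any? (λ x → (adj G w x Bool.≟ true) ×-dec ¬? (covered? rest x))
    ... | yes (x , wx , x∉rest) =
      let (e , e-edge , w∈e , x∈e) = edgeBetween wx
      in swap e-edge w∈e x∈e (λ x≡w → adj⇒≢ wx (sym x≡w)) x∉rest
    ... | no no-free-neighbour =
      drop λ {x} wx → decidable-stable (covered? rest x) (λ x∉rest → no-free-neighbour (x , wx , x∉rest))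

  bestEdgeSet : EdgeSet G
  bestEdgeSet = record
    { edges  = best
    ; valid  = best-AreEdges
    ; unique = Unique-resp-⊇ (proj₁ best-⊆-InΘ) allEdges-Unique
    }

  best-matching : IsMatching bestEdgeSet
  best-matching {e} e∈best f∈best e≢f meet =
    let (u , u∈e , u∈f) = Meet⇒shared meet
        (w , f-joins)   = Ends⇒Joins u∈f
    in best-unimprovable (Exchange.improve best-AreEdges best-InΘ f∈best f-joins
                                           (e , ∈-filter⁺ _ e∈best e≢f , u∈e))

  best-maximal : (F : EdgeSet G) → IsMatching F → bestEdgeSet ⊆E F → F ⊆E bestEdgeSet
  best-maximal F F-matching best⊆F {g@(x , y)} g∈F with g ∈? best
  ... | yes g∈best = g∈best
  ... | no g∉best  = contradiction (best-InΘ x y (free (inj₁ refl)) (free (inj₂ refl)))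
                                   (Bool.not-¬ (proj₂ (All.lookup (valid F) g∈F)))
    where
    free : ∀ {v} → Ends v g → ¬ CoveredBy best v
    free v∈g (h , h∈best , v∈h) =
      F-matching (best⊆F h∈best) g∈F (λ h≡g → g∉best (subst (_∈ best) h≡g h∈best))
                 (shared⇒Meet v∈h v∈g)

  best-size-minimal : (F : EdgeSet G) → InTheta F → size bestEdgeSet ≤ size F
  best-size-minimal F θ = lex-≤⇒≤ (suc (n G)) (uncovered<1+n (edges F)) (best-minimal (valid F) θ)

lemma3 : (G : Graph) → ∃[ E₀ ] (IsMaximalMatching {G} E₀ × IsTau G (size E₀))
lemma3 G = bestEdgeSet G
         , (best-matching G , best-maximal G)
         , ((bestEdgeSet G , best-InΘ G , refl) , best-size-minimal G)
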